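{- Define a strictly increasing sequence of positive integers $(c(n))_{n\ge1}$ by $c(1)=1$, $c(2)=4$, and for $n\ge 3$, $c(n)=c(n-1)+\epsilon_n$, where $\epsilon_n\in\{1,2\}$ is given as follows: let $n$ be called "in the sequence" if $n\in\{c(1),\dots,c(n-1)\}$; then $\epsilon_n=1$ if either ($n$ is in the sequence and $c(n-1)$ is even) or ($n$ is not in the sequence and $c(n-1)$ is odd), and $\epsilon_n=2$ otherwise. Then every odd integer $\ge 7$ is a term of the sequence $(c(n))$.
   Context: Since $c(2)=4$ and the sequence increases by at least $1$ at each step, $c(n-1)\ge n+1$ for $n\ge3$, so membership of $n$ in the full set of values $\{c(k):k\ge1\}$ is determined by $c(1),\dots,c(n-1)$. With this rule the sequence is the unique increasing sequence in which $c(n+1)$ is the smallest number $>c(n)$ consistent with the condition "$n$ is a term of the sequence if and only if $c(n)$ is odd" (OEIS A079000); it begins $1,4,6,7,8,9,11,13,15,16,17,18,\dots$. -}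

module Defs where

open import Data.Nat using (ℕ; zero; suc; _+_; _%_; _≡ᵇ_)
open import Data.Bool using (Bool; true; false; _∧_; _∨_; not; if_then_else_)
open import Data.List using (List; []; _∷_; _++_)
open import Data.Bool.ListAction using (any)
open import Data.Product using (_×_; _,_; proj₁; proj₂)

isIn : ℕ → List ℕ → Bool
isIn n xs = any (λ x → x ≡ᵇ n) xs

isEven : ℕ → Bool
isEven m = m % 2 ≡ᵇ 0

-- epsilon_n, given n, the prefix [c(1),…,c(n-1)] and c(n-1)
eps : ℕ → List ℕ → ℕ → ℕ
eps n pre prev =
  if (isIn n pre ∧ isEven prev) ∨ (not (isIn n pre) ∧ not (isEven prev))
  then 1 else 2

-- prefixData k = ([c(1),…,c(k)], c(k))   (for k ≥ 1; c(0) := 0 is a dummy)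
prefixData : ℕ → List ℕ × ℕ
prefixData zero = [] , 0
prefixData (suc zero) = 1 ∷ [] , 1
prefixData (suc (suc zero)) = 1 ∷ 4 ∷ [] , 4
prefixData (suc (suc (suc m))) =
  let p = prefixData (suc (suc m))
      new = proj₂ p + eps (suc (suc (suc m))) (proj₁ p) (proj₂ p)
  in proj₁ p ++ (new ∷ []) , new

c : ℕ → ℕ
c n = proj₂ (prefixData n)

-- Suppose an odd m ≥ 7 is skipped: c(n) < m < c(n+1) ≤ c(n) + 2 for some n ≥ 2, so
-- c(n) is even, m = c(n) + 1 and ε_{n+1} = 2. But ε_{n+1} = 1 as soon as n + 1 is an
-- earlier term, and by strong induction on m it is: n + 1 < m, so if n + 1 is odd it
-- is a term; otherwise n is odd, hence a term, and a term n always has c(n) odd.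
module Submission where

open import Defs
open import Data.Nat using (ℕ; zero; suc; _+_; _%_; _≤_; _<_; z≤n; s≤s; s≤s⁻¹; _≡ᵇ_)
open import Data.Nat.Properties
  using (≤-refl; ≤-trans; ≤-reflexive; ≤-antisym; ≤-<-trans; <⇒≤; <-irrefl;
         m≤n⇒m<n∨m≡n; m≤n⇒m≤1+n; m<m+n; m≤m+n; +-monoʳ-≤; +-comm; ≡⇒≡ᵇ; module ≤-Reasoning)
open import Data.Nat.Induction using (<-rec)
open import Data.Bool using (true; false; _∧_; _∨_; not; if_then_else_)
open import Data.Bool.Properties using (∨-assoc; ∨-zeroʳ; not-injective; T-≡)
open import Data.List using (List; []; _∷_; _++_)
open import Data.Product using (∃-syntax; _×_; _,_; proj₁)
open import Data.Sum using (inj₁; inj₂)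
open import Data.Empty using (⊥-elim)
open import Function.Bundles using (Equivalence)
open import Relation.Nullary using (contradiction)
open import Relation.Binary.PropositionalEquality
  using (_≡_; refl; sym; trans; cong; subst; module ≡-Reasoning)

pre : ℕ → List ℕ
pre n = proj₁ (prefixData n)

IsTerm : ℕ → Set
IsTerm m = ∃[ k ] (1 ≤ k × c k ≡ m)

OddIsTerm : ℕ → Set
OddIsTerm m = 7 ≤ m → isEven m ≡ false → IsTerm m

isEven-suc : ∀ n → isEven (suc n) ≡ not (isEven n)
isEven-suc zero = refl
isEven-suc (suc zero) = refl
isEven-suc (suc (suc n)) = isEven-suc n

odd⇒¬isEven : ∀ n → n % 2 ≡ 1 → isEven n ≡ false
odd⇒¬isEven n n%2≡1 rewrite n%2≡1 = refl

isIn-++ : ∀ n xs ys → isIn n (xs ++ ys) ≡ isIn n xs ∨ isIn n ys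
isIn-++ n [] ys = refl
isIn-++ n (x ∷ xs) ys = begin
  (x ≡ᵇ n) ∨ isIn n (xs ++ ys)        ≡⟨ cong ((x ≡ᵇ n) ∨_) (isIn-++ n xs ys) ⟩
  (x ≡ᵇ n) ∨ (isIn n xs ∨ isIn n ys)  ≡⟨ ∨-assoc (x ≡ᵇ n) _ _ ⟨
  ((x ≡ᵇ n) ∨ isIn n xs) ∨ isIn n ys  ∎
  where open ≡-Reasoning

isIn-[_] : ∀ n → isIn n (n ∷ []) ≡ true
isIn-[ n ] = cong (_∨ false) (Equivalence.to T-≡ (≡⇒≡ᵇ n n refl))

eps-≥1 : ∀ n xs m → 1 ≤ eps n xs m
eps-≥1 n xs m with (isIn n xs ∧ isEven m) ∨ (not (isIn n xs) ∧ not (isEven m))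
... | true = ≤-refl
... | false = s≤s z≤n

eps-≤2 : ∀ n xs m → eps n xs m ≤ 2
eps-≤2 n xs m with (isIn n xs ∧ isEven m) ∨ (not (isIn n xs) ∧ not (isEven m))
... | true = s≤s z≤n
... | false = ≤-refl

eps-isIn : ∀ n xs m → isIn n xs ≡ true → eps n xs m ≡ (if isEven m then 1 else 2)
eps-isIn n xs m n∈xs rewrite n∈xs with isEven m
... | true = refl
... | false = refl

pre-suc : ∀ n → 1 ≤ n → pre (suc n) ≡ pre n ++ c (suc n) ∷ []
pre-suc (suc zero) _ = refl
pre-suc (suc (suc n)) _ = refl

c-suc : ∀ n → 2 ≤ n → c (suc n) ≡ c n + eps (suc n) (pre n) (c n)
c-suc (suc zero) (s≤s ())
c-suc (suc (suc n)) _ = refl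

c-suc-≤ : ∀ n → 2 ≤ n → c (suc n) ≤ 2 + c n
c-suc-≤ n 2≤n = begin
  c (suc n)                            ≡⟨ c-suc n 2≤n ⟩
  c n + eps (suc n) (pre n) (c n)      ≤⟨ +-monoʳ-≤ (c n) (eps-≤2 (suc n) (pre n) (c n)) ⟩
  c n + 2                              ≡⟨ +-comm (c n) 2 ⟩
  2 + c n                              ∎
  where open ≤-Reasoning

c-<-suc : ∀ n → 1 ≤ n → c n < c (suc n)
c-<-suc (suc zero) _ = s≤s (s≤s z≤n)
c-<-suc (suc (suc n)) _ =
  subst (c (suc (suc n)) <_) (sym (c-suc (suc (suc n)) (s≤s (s≤s z≤n))))
    (m<m+n _ (eps-≥1 (suc (suc (suc n))) (pre (suc (suc n))) (c (suc (suc n)))))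

n<c : ∀ n → 2 ≤ n → n < c n
n<c (suc zero) (s≤s ())
n<c (suc (suc zero)) _ = s≤s (s≤s (s≤s z≤n))
n<c (suc (suc (suc n))) _ =
  ≤-<-trans (n<c (suc (suc n)) (s≤s (s≤s z≤n))) (c-<-suc (suc (suc n)) (s≤s z≤n))

isIn-pre-suc : ∀ {x} j → 1 ≤ j → isIn x (pre (suc j)) ≡ isIn x (pre j) ∨ isIn x (c (suc j) ∷ [])
isIn-pre-suc {x} j 1≤j = trans (cong (isIn x) (pre-suc j 1≤j)) (isIn-++ x (pre j) (c (suc j) ∷ []))

pre-⊆-suc : ∀ {x} j → 1 ≤ j → isIn x (pre j) ≡ true → isIn x (pre (suc j)) ≡ true
pre-⊆-suc {x} j 1≤j x∈pre = trans (isIn-pre-suc j 1≤j) (cong (_∨ isIn x (c (suc j) ∷ [])) x∈pre)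

c∈pre-self : ∀ n → 1 ≤ n → isIn (c n) (pre n) ≡ true
c∈pre-self (suc zero) _ = refl
c∈pre-self (suc (suc n)) _ = begin
  isIn last (pre (suc (suc n)))                  ≡⟨ isIn-pre-suc (suc n) (s≤s z≤n) ⟩
  isIn last (pre (suc n)) ∨ isIn last (last ∷ []) ≡⟨ cong (isIn last (pre (suc n)) ∨_) isIn-[ last ] ⟩
  isIn last (pre (suc n)) ∨ true                  ≡⟨ ∨-zeroʳ (isIn last (pre (suc n))) ⟩
  true                                            ∎
  where
  open ≡-Reasoning
  last : ℕ
  last = c (suc (suc n))

c∈pre : ∀ k j → 1 ≤ k → k ≤ j → isIn (c k) (pre j) ≡ true
c∈pre k j 1≤k k≤j with m≤n⇒m<n∨m≡n k≤j
c∈pre k .k 1≤k _ | inj₂ refl = c∈pre-self k 1≤k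
c∈pre k (suc j) 1≤k _ | inj₁ (s≤s k≤j) = pre-⊆-suc j (≤-trans 1≤k k≤j) (c∈pre k j 1≤k k≤j)

term∈pre : ∀ {n} → 1 ≤ n → IsTerm (suc n) → isIn (suc n) (pre n) ≡ true
term∈pre () (suc zero , _ , refl)
term∈pre {n} _ (suc (suc k) , _ , ck≡n+1) =
  subst (λ x → isIn x (pre n) ≡ true) ck≡n+1 (c∈pre (suc (suc k)) n (s≤s z≤n) k≤n)
  where
  k≤n : suc (suc k) ≤ n
  k≤n = s≤s⁻¹ (subst (suc (suc k) <_) ck≡n+1 (n<c (suc (suc k)) (s≤s (s≤s z≤n))))

c-suc-isIn : ∀ n → 2 ≤ n → isIn (suc n) (pre n) ≡ true
           → c (suc n) ≡ (if isEven (c n) then 1 else 2) + c n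
c-suc-isIn n 2≤n n+1∈pre = begin
  c (suc n)                            ≡⟨ c-suc n 2≤n ⟩
  c n + eps (suc n) (pre n) (c n)      ≡⟨ cong (c n +_) (eps-isIn (suc n) (pre n) (c n) n+1∈pre) ⟩
  c n + (if isEven (c n) then 1 else 2) ≡⟨ +-comm (c n) _ ⟩
  (if isEven (c n) then 1 else 2) + c n ∎
  where open ≡-Reasoning

isEven-c-suc-isIn : ∀ n → 2 ≤ n → isIn (suc n) (pre n) ≡ true → isEven (c (suc n)) ≡ false
isEven-c-suc-isIn n 2≤n n+1∈pre rewrite c-suc-isIn n 2≤n n+1∈pre with isEven (c n) in even
... | true = trans (isEven-suc (c n)) (cong not even)
... | false = even

-- For n ≤ 6 this is checked directly (n = 2, where 3 is not a term, is excluded by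
-- 7 ≤ c(n) + 1); for n ≥ 7 the hypothesis applies to whichever of n, n + 1 is odd.
suc-index∈pre : ∀ {n} → 2 ≤ n → 7 ≤ suc (c n) → isEven (c n) ≡ true
              → (∀ {m} → m < suc (c n) → OddIsTerm m) → isIn (suc n) (pre n) ≡ true
suc-index∈pre {2} _ (s≤s (s≤s (s≤s (s≤s (s≤s ()))))) _ _
suc-index∈pre {3} _ _ _ _ = refl
suc-index∈pre {4} _ _ () _
suc-index∈pre {5} _ _ _ _ = refl
suc-index∈pre {6} _ _ () _
suc-index∈pre {n@(suc n-1@(suc (suc (suc (suc (suc (suc u)))))))} 2≤n _ cn-even ih
  with isEven n in n-even
... | true = term∈pre (s≤s z≤n)
               (ih (s≤s (n<c n 2≤n)) (m≤n⇒m≤1+n (m≤m+n 7 u)) (trans (isEven-suc n) (cong not n-even)))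
... | false = contradiction (trans (sym cn-even) (isEven-c-suc-isIn n-1 (s≤s (s≤s z≤n)) n∈pre)) λ ()
  where
  n∈pre : isIn n (pre n-1) ≡ true
  n∈pre = term∈pre (s≤s z≤n) (ih (s≤s (<⇒≤ (n<c n 2≤n))) (m≤m+n 7 u) n-even)

odd-gap-closed : ∀ {n} → 2 ≤ n → 7 ≤ suc (c n) → isEven (suc (c n)) ≡ false
               → (∀ {m} → m < suc (c n) → OddIsTerm m) → c (suc n) ≡ suc (c n)
odd-gap-closed {n} 2≤n 7≤cn+1 odd ih =
  trans (c-suc-isIn n 2≤n n+1∈pre) (cong (λ b → (if b then 1 else 2) + c n) cn-even)
  where
  cn-even : isEven (c n) ≡ true
  cn-even = not-injective (trans (sym (isEven-suc (c n))) odd)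
  n+1∈pre : isIn (suc n) (pre n) ≡ true
  n+1∈pre = suc-index∈pre 2≤n 7≤cn+1 cn-even ih

bracket : ∀ m → 4 ≤ m → ∃[ n ] (2 ≤ n × c n ≤ m × m < c (suc n))
bracket m 4≤m with m≤n⇒m<n∨m≡n 4≤m
bracket .4 _ | inj₂ refl = 2 , s≤s (s≤s z≤n) , ≤-refl , s≤s (s≤s (s≤s (s≤s (s≤s z≤n))))
bracket (suc m) _ | inj₁ (s≤s 4≤m) with bracket m 4≤m
... | n , 2≤n , cn≤m , m<cn+1 with m≤n⇒m<n∨m≡n m<cn+1
...   | inj₁ m+1<cn+1 = n , 2≤n , m≤n⇒m≤1+n cn≤m , m+1<cn+1
...   | inj₂ m+1≡cn+1 = suc n , m≤n⇒m≤1+n 2≤n , ≤-reflexive (sym m+1≡cn+1)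
                        , subst (_< c (suc (suc n))) (sym m+1≡cn+1) (c-<-suc (suc n) (s≤s z≤n))

squeeze : ∀ {a m b} → a < m → m < b → b ≤ 2 + a → m ≡ suc a
squeeze a<m m<b b≤2+a = ≤-antisym (s≤s⁻¹ (≤-trans m<b b≤2+a)) a<m

oddIsTerm : ∀ m → OddIsTerm m
oddIsTerm = <-rec OddIsTerm step
  where
  step : ∀ m → (∀ {m′} → m′ < m → OddIsTerm m′) → OddIsTerm m
  step m ih 7≤m odd with bracket m (≤-trans (s≤s (s≤s (s≤s (s≤s z≤n)))) 7≤m)
  ... | n , 2≤n , cn≤m , m<cn+1 with m≤n⇒m<n∨m≡n cn≤m
  ...   | inj₂ cn≡m = n , ≤-trans (s≤s z≤n) 2≤n , cn≡m
  ...   | inj₁ cn<m with squeeze cn<m m<cn+1 (c-suc-≤ n 2≤n)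
  ...     | refl = ⊥-elim (<-irrefl (sym (odd-gap-closed 2≤n 7≤m odd ih)) m<cn+1)

mainTheorem2 : (m : ℕ) → 7 ≤ m → m % 2 ≡ 1 → ∃[ k ] (1 ≤ k × c k ≡ m)
mainTheorem2 m 7≤m m%2≡1 = oddIsTerm m 7≤m (odd⇒¬isEven m m%2≡1)
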